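{- Let $T$ be a tree with $\operatorname{diam}(T)=5$ and let $T\overline{T}$ be its complementary prism. If $u,v$ are adjacent vertices of $T$ such that $u$ is a peripheral vertex of $T$, then $V(\overline{T})\subseteq [\{\overline{u},\overline{v}\}]_{T\overline{T}}$.
   Context: For a graph $G$ with complement $\overline{G}$, the complementary prism $G\overline{G}$ is the graph obtained from the disjoint union of $G$ and $\overline{G}$ by adding the perfect matching joining each vertex $v$ of $G$ to its copy $\overline{v}$ in $\overline{G}$. A vertex $u$ of $T$ is peripheral if its eccentricity $\max_{w\in V(T)} d_T(u,w)$ equals $\operatorname{diam}(T)$. For a graph $H$, a set $S\subseteq V(H)$ is (geodesically) convex if every vertex on every shortest path between two vertices of $S$ belongs to $S$; the convex hull $[S]_H$ is the smallest convex set of $H$ containing $S$. -}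

module Defs where

open import Level using (Level; 0ℓ)
open import Data.Nat using (ℕ; zero; suc; _≤_; _+_)
open import Data.Fin using (Fin)
open import Data.Sum using (_⊎_; inj₁; inj₂)
open import Data.Product using (Σ; _×_; _,_; ∃; ∃-syntax)
open import Data.Empty using (⊥)
open import Data.List using (List; []; _∷_)
open import Data.List.Membership.Propositional using (_∈_)
open import Data.List.Relation.Unary.Unique.Propositional using (Unique)
open import Relation.Nullary using (¬_)
open import Relation.Binary.PropositionalEquality using (_≡_; _≢_)

Graph : Set → Set₁
Graph V = V → V → Set

record IsSimple {V : Set} (G : Graph V) : Set where
  field
    sym   : ∀ {u v} → G u v → G v u
    irrefl : ∀ {u} → ¬ G u u

data Walk {V : Set} (G : Graph V) : V → V → ℕ → Set where
  [_]  : (u : V) → Walk G u u zero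
  _∷⟨_⟩_ : ∀ {v w k} (u : V) → G u v → Walk G v w k → Walk G u w (suc k)

vertices : ∀ {V : Set} {G : Graph V} {u v : V} {k : ℕ} → Walk G u v k → List V
vertices [ u ] = u ∷ []
vertices (u ∷⟨ _ ⟩ p) = u ∷ vertices p

IsPath : ∀ {V : Set} {G : Graph V} {u v : V} {k : ℕ} → Walk G u v k → Set
IsPath p = Unique (vertices p)

Connected : {V : Set} → Graph V → Set
Connected {V} G = ∀ (u v : V) → ∃[ k ] Walk G u v k

HasCycle : {V : Set} → Graph V → Set
HasCycle {V} G =
  Σ V λ u → Σ V λ v → G u v × Σ ℕ λ k → 2 ≤ k × Σ (Walk G v u k) IsPath

record IsTree {n : ℕ} (T : Graph (Fin n)) : Set where
  field
    simple    : IsSimple T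
    connected : Connected T
    acyclic   : ¬ HasCycle T

Dist : {V : Set} → Graph V → V → V → ℕ → Set
Dist G u v k = Walk G u v k × (∀ {m} → Walk G u v m → k ≤ m)

Diam : {V : Set} → Graph V → ℕ → Set
Diam {V} G D =
  (∀ (u v : V) (k : ℕ) → Dist G u v k → k ≤ D)
  × Σ V λ u → Σ V λ v → Dist G u v D

Ecc : {V : Set} → Graph V → V → ℕ → Set
Ecc {V} G u e =
  (∀ (w : V) (k : ℕ) → Dist G u w k → k ≤ e) × Σ V λ w → Dist G u w e

Peripheral : {V : Set} → Graph V → V → Set
Peripheral G u = ∃[ D ] (Diam G D × Ecc G u D)

Complement : {V : Set} → Graph V → Graph V
Complement G u v = (u ≢ v) × ¬ G u v

-- Complementary prism G Ḡ: vertices inj₁ v (copy in G) and inj₂ v (copy v̄ in Ḡ).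
data Prism {V : Set} (G : Graph V) : Graph (V ⊎ V) where
  inG    : ∀ {u v} → G u v → Prism G (inj₁ u) (inj₁ v)
  inCo   : ∀ {u v} → Complement G u v → Prism G (inj₂ u) (inj₂ v)
  match₁ : ∀ {v} → Prism G (inj₁ v) (inj₂ v)
  match₂ : ∀ {v} → Prism G (inj₂ v) (inj₁ v)

Subset : Set → Set₁
Subset V = V → Set

Convex : {V : Set} → Graph V → Subset V → Set
Convex {V} G C =
  ∀ {x y : V} {k : ℕ} → C x → C y → Dist G x y k →
  (p : Walk G x y k) → ∀ {z} → z ∈ vertices p → C z

Hull : {V : Set} → Graph V → Subset V → V → Set₁
Hull {V} G S z = (C : Subset V) → Convex G C → (∀ {x} → S x → C x) → C z

Pair : {V : Set} → V → V → Subset V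
Pair a b x = (x ≡ a) ⊎ (x ≡ b)

module Submission where

-- Let C be any convex set of the prism T T̄ containing ū and v̄;
-- we show w̄ ∈ C for every vertex w of T.
--  * Key convexity fact: if xy is an edge of T then x̄ and ȳ are at distance 2
--    in the prism, so every common neighbour w̄ of x̄, ȳ in T̄ lies in C.
--  * Every vertex z at distance ≥ 4 from u is non-adjacent to u and v in T,
--    so z̄ is a common T̄-neighbour of ū, v̄, hence z̄ ∈ C.
--  * Since u is peripheral and diam T = 5, a geodesic from u of length ≥ 5
--    ends in an edge cd of T with c, d at distance ≥ 4 from u; so c̄, d̄ ∈ C,
--    and every w within distance 2 of u is a common T̄-neighbour of c̄, d̄.
--  * Finally, in a tree adjacency is decidable, so each w is either within
--    distance 1 of u or of v (hence within distance 2 of u), or a common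
--    T̄-neighbour of ū and v̄.

open import Defs
open import Data.Nat using (ℕ; zero; suc; _+_; _≤_; z≤n; s≤s; s≤s⁻¹)
open import Data.Nat.Properties using (≤-trans; n≮n; m≤n+m)
open import Data.Fin using (Fin; _≟_)
open import Data.Sum using (inj₁; inj₂; _⊎_)
open import Data.Product using (Σ; _×_; _,_; ∃-syntax; proj₂)
open import Data.Empty using (⊥-elim)
open import Data.List.Relation.Unary.Any using (here; there)
open import Data.List.Relation.Unary.All.Properties using (¬Any⇒All¬)
open import Data.List.Relation.Unary.AllPairs using ([]; _∷_)
import Data.List.Relation.Unary.All as All
open import Relation.Nullary using (¬_; yes; no)
open import Relation.Binary.Definitions using (DecidableEquality)
open import Relation.Binary.PropositionalEquality using (_≡_; _≢_; refl; sym; subst)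

walk-length-zero : ∀ {V} {G : Graph V} {a b} → Walk G a b 0 → a ≡ b
walk-length-zero [ _ ] = refl

walk-length-one : ∀ {V} {G : Graph V} {a b} → Walk G a b 1 → G a b
walk-length-one (_ ∷⟨ e ⟩ [ _ ]) = e

snoc : ∀ {V} {G : Graph V} {a b c m} → Walk G a c m → G c b → Walk G a b (suc m)
snoc [ a ] e = a ∷⟨ e ⟩ [ _ ]
snoc (a ∷⟨ e ⟩ p) f = a ∷⟨ e ⟩ snoc p f

unsnoc : ∀ {V} {G : Graph V} {a b k} → Walk G a b (suc k) →
         Σ V λ c → Walk G a c k × G c b
unsnoc (a ∷⟨ e ⟩ [ _ ]) = a , [ a ] , e
unsnoc (a ∷⟨ e ⟩ (b ∷⟨ f ⟩ p)) with unsnoc (b ∷⟨ f ⟩ p)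
... | c , q , g = c , a ∷⟨ e ⟩ q , g

-- With decidable vertex equality every walk can be shortened to a path
-- (by cutting out the detour between two visits of the same vertex).
module _ {V : Set} (_≟V_ : DecidableEquality V) (G : Graph V) where
  open import Data.List.Membership.DecPropositional _≟V_ using (_∈?_; _∈_)

  path-suffix : ∀ {a b k x} (q : Walk G a b k) → IsPath q → x ∈ vertices q →
                ∃[ k' ] Σ (Walk G x b k') IsPath
  path-suffix [ a ] uq (here refl) = _ , [ a ] , uq
  path-suffix (a ∷⟨ e ⟩ q) uq (here refl) = _ , a ∷⟨ e ⟩ q , uq
  path-suffix (a ∷⟨ e ⟩ q) (_ ∷ uq) (there x∈q) = path-suffix q uq x∈q

  walk⇒path : ∀ {a b k} → Walk G a b k → ∃[ k' ] Σ (Walk G a b k') IsPath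
  walk⇒path [ a ] = 0 , [ a ] , All.[] ∷ []
  walk⇒path (a ∷⟨ e ⟩ p) with walk⇒path p
  ... | k , q , uq with a ∈? vertices q
  ... | yes a∈q = path-suffix q uq a∈q
  ... | no a∉q = suc k , a ∷⟨ e ⟩ q , ¬Any⇒All¬ _ a∉q ∷ uq

-- In a tree, two distinct vertices are adjacent or not: the path joining
-- them has length 1, or it has length ≥ 2 and an edge would close a cycle.
tree-adjacency : ∀ {n} {T : Graph (Fin n)} → IsTree T →
                 ∀ a w → a ≢ w → T a w ⊎ ¬ T a w
tree-adjacency {T = T} tree a w a≢w
  with walk⇒path _≟_ T (proj₂ (IsTree.connected tree a w))
... | zero , p , _ = ⊥-elim (a≢w (walk-length-zero p))
... | suc zero , p , _ = inj₁ (walk-length-one p)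
... | suc (suc k) , p , path = inj₂ λ e → IsTree.acyclic tree
  (w , a , IsSimple.sym (IsTree.simple tree) e , suc (suc k) , s≤s (s≤s z≤n) , p , path)

close-or-co-adjacent : ∀ {n} {T : Graph (Fin n)} → IsTree T →
                       ∀ a w → (a ≡ w ⊎ T a w) ⊎ Complement T a w
close-or-co-adjacent tree a w with a ≟ w
... | yes a≡w = inj₁ (inj₁ a≡w)
... | no a≢w with tree-adjacency tree a w a≢w
...   | inj₁ e = inj₁ (inj₂ e)
...   | inj₂ ¬e = inj₂ (a≢w , ¬e)

complement-sym : ∀ {V} {G : Graph V} → IsSimple G →
                 ∀ {x y} → Complement G x y → Complement G y x
complement-sym simple (x≢y , ¬e) = (λ y≡x → x≢y (sym y≡x)) , (λ e → ¬e (IsSimple.sym simple e))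

DistAtLeast : ∀ {V} → Graph V → V → V → ℕ → Set
DistAtLeast G u z r = ∀ {i} → Walk G u z i → r ≤ i

far⇒co-adjacent : ∀ {V} {G : Graph V} {u x z j r} → DistAtLeast G u z r →
                  2 + j ≤ r → Walk G u x j → Complement G x z
far⇒co-adjacent {j = j} far 2+j≤r q =
    (λ x≡z → n≮n j (≤-trans (m≤n+m (suc j) 1) (≤-trans 2+j≤r (far (subst (λ y → Walk _ _ y j) x≡z q)))))
  , (λ e → n≮n (suc j) (≤-trans 2+j≤r (far (snoc q e))))

last-edge-of-geodesic : ∀ {V} {G : Graph V} {u d k} → Dist G u d (suc k) →
                        Σ V λ c → G c d × DistAtLeast G u c k
last-edge-of-geodesic (p , shortest) with unsnoc p
... | c , _ , e = c , e , λ q → s≤s⁻¹ (shortest (snoc q e))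

-- A peripheral vertex u of a graph of diameter 5 is at distance ≥ 4 from
-- both ends of some edge cd (the last edge of a longest geodesic from u).
peripheral-far-edge : ∀ {V} {G : Graph V} {u} → Diam G 5 → Peripheral G u →
                      Σ V λ c → Σ V λ d → G c d × DistAtLeast G u c 4 × DistAtLeast G u d 4
peripheral-far-edge (_ , a , b , dist-ab) (D , (bounded , _) , _ , d , geodesic)
  with bounded a b 5 dist-ab
... | 5≤D@(s≤s 4≤k) with last-edge-of-geodesic geodesic
...   | c , e , c-far = c , d , e , (λ q → ≤-trans 4≤k (c-far q))
                                  , (λ q → ≤-trans (m≤n+m 4 1) (≤-trans 5≤D (proj₂ geodesic q)))

convex-midpoint : ∀ {V} {G : Graph V} {C : Subset V} → Convex G C →
                  ∀ {x y w} → C x → C y → G x w → G w y →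
                  DistAtLeast G x y 2 → C w
convex-midpoint convex {x} {y} {w} cx cy e f far =
  convex cx cy (p , far) p (there (here refl))
  where
  p : Walk _ x y 2
  p = x ∷⟨ e ⟩ (w ∷⟨ f ⟩ [ y ])

-- If xy is an edge of a simple graph T, then x̄ and ȳ are at distance ≥ 2
-- in the prism, as they are distinct and not adjacent in T̄.
edge-far-in-prism : ∀ {V} {T : Graph V} → IsSimple T → ∀ {x y} → T x y →
                    DistAtLeast (Prism T) (inj₂ x) (inj₂ y) 2
edge-far-in-prism simple e {zero} q with walk-length-zero q
... | refl = ⊥-elim (IsSimple.irrefl simple e)
edge-far-in-prism simple e {suc zero} q with walk-length-one q
... | inCo (_ , ¬e) = ⊥-elim (¬e e)
edge-far-in-prism simple e {suc (suc _)} q = s≤s (s≤s z≤n)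

convex-co-neighbour : ∀ {V} {T : Graph V} {C : Subset (V ⊎ V)} → IsSimple T →
                      Convex (Prism T) C → ∀ {x y w} → T x y →
                      C (inj₂ x) → C (inj₂ y) → Complement T x w → Complement T w y →
                      C (inj₂ w)
convex-co-neighbour simple convex e cx cy xw wy =
  convex-midpoint convex cx cy (inCo xw) (inCo wy) (edge-far-in-prism simple e)

lemma3p4 : (n : ℕ) (T : Graph (Fin n)) → IsTree T → Diam T 5 →
    (u v : Fin n) → T u v → Peripheral T u →
    (w : Fin n) → Hull (Prism T) (Pair (inj₂ u) (inj₂ v)) (inj₂ w)
lemma3p4 n T tree diam u v uv peripheral w C convex pair⊆C = goal
  where
  simple : IsSimple T
  simple = IsTree.simple tree
  cu : C (inj₂ u)
  cu = pair⊆C (inj₁ refl)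
  cv : C (inj₂ v)
  cv = pair⊆C (inj₂ refl)
  mid : ∀ {x y z} → T x y → C (inj₂ x) → C (inj₂ y) →
        Complement T x z → Complement T z y → C (inj₂ z)
  mid = convex-co-neighbour simple convex
  -- Vertices at distance ≥ 4 from u are common T̄-neighbours of ū and v̄.
  far-in-C : ∀ {z} → DistAtLeast T u z 4 → C (inj₂ z)
  far-in-C far = mid uv cu cv (far⇒co-adjacent far (s≤s (s≤s z≤n)) [ u ])
                    (complement-sym simple (far⇒co-adjacent far (s≤s (s≤s (s≤s z≤n))) (u ∷⟨ uv ⟩ [ v ])))
  -- Vertices within distance 2 of u are common T̄-neighbours of c̄ and d̄.
  near-in-C : ∀ {x j} → j ≤ 2 → Walk T u x j → C (inj₂ x)
  near-in-C j≤2 q with peripheral-far-edge diam peripheral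
  ... | c , d , cd , c-far , d-far =
    mid cd (far-in-C c-far) (far-in-C d-far)
        (complement-sym simple (far⇒co-adjacent c-far (s≤s (s≤s j≤2)) q))
        (far⇒co-adjacent d-far (s≤s (s≤s j≤2)) q)
  goal : C (inj₂ w)
  goal with close-or-co-adjacent tree u w | close-or-co-adjacent tree v w
  ... | inj₁ (inj₁ refl) | _ = near-in-C z≤n [ u ]
  ... | inj₁ (inj₂ uw) | _ = near-in-C (s≤s z≤n) (u ∷⟨ uw ⟩ [ w ])
  ... | inj₂ _ | inj₁ (inj₁ refl) = near-in-C (s≤s z≤n) (u ∷⟨ uv ⟩ [ v ])
  ... | inj₂ _ | inj₁ (inj₂ vw) = near-in-C (s≤s (s≤s z≤n)) (u ∷⟨ uv ⟩ (v ∷⟨ vw ⟩ [ w ]))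
  ... | inj₂ uw | inj₂ vw = mid uv cu cv uw (complement-sym simple vw)
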